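{- Let $\mathcal{K}=\langle\mathcal{T},\mathcal{A}\rangle$ be a KB and let $F_{\mathcal{K}}$ be the SETAF corresponding to the PSETAF $F_{\mathcal{K},\succ_\emptyset}$, where $\succ_\emptyset$ is the empty relation (so $F_{\mathcal{K}}=(\mathcal{A},\rightsquigarrow_{\mathcal{K}})$). Then the grounded extension of $F_{\mathcal{K}}$ equals the intersection of all repairs of $\mathcal{K}$.
   Context: $\mathcal{K}=\langle\mathcal{T},\mathcal{A}\rangle$: description-logic TBox $\mathcal{T}$ and finite ABox $\mathcal{A}$. $\mathcal{B}\subseteq\mathcal{A}$ is $\mathcal{T}$-consistent if $\langle\mathcal{T},\mathcal{B}\rangle$ has a model. A repair is an inclusion-maximal $\mathcal{T}$-consistent subset of $\mathcal{A}$; a conflict is an inclusion-minimal $\mathcal{T}$-inconsistent subset, $\mathit{conf}(\mathcal{K})$ the set of conflicts. Standing assumption: no single assertion is $\mathcal{T}$-inconsistent. $\rightsquigarrow_{\mathcal{K}}=\{(C\setminus\{\alpha\},\alpha)\mid C\in\mathit{conf}(\mathcal{K}),\alpha\in C\}$. For a SETAF $(\mathit{Args},\rightsquigarrow)$ (attacks $S\rightsquigarrow\alpha$ with $S$ nonempty), $S^+=\{\alpha\mid\exists T\subseteq S,T\rightsquigarrow\alpha\}$ and the characteristic function is $\Gamma(S)=\{\alpha\mid$ for every $T\rightsquigarrow\alpha$, $T\cap S^+\neq\emptyset\}$; $\Gamma$ is monotone and the grounded extension is its least fixpoint (equivalently $\bigcup_{d\ge0}\Gamma^d(\emptyset)$).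 -}

module Defs where

open import Data.Nat using (ℕ; zero; suc)
open import Data.Fin using (Fin)
open import Data.Fin.Subset using (Subset; _∈_; _∉_; _⊆_; _⊂_; ⁅_⁆; _-_; Nonempty)
open import Data.Product using (Σ; ∃; _×_)
open import Data.Empty using (⊥)
open import Relation.Nullary using (¬_; Dec)
open import Relation.Binary.PropositionalEquality using (_≡_)
open import Function.Bundles using (_⇔_)

-- The ABox is finite with n assertions, indexed by Fin n.  The
-- description-logic semantics is abstracted into a type of
-- interpretations, the predicate "I is a model of the TBox T", and the
-- satisfaction relation "I satisfies the assertion α".
record KB (n : ℕ) : Set₁ where
  field
    Interp   : Set
    ModelOfT : Interp → Set
    Sat      : Interp → Fin n → Set

module _ {n : ℕ} (K : KB n) where
  open KB K

  Consistent : Subset n → Set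
  Consistent B = Σ Interp λ I → ModelOfT I × (∀ α → α ∈ B → Sat I α)

  IsRepair : Subset n → Set
  IsRepair R = Consistent R × (∀ S → R ⊂ S → ¬ Consistent S)

  IsConflict : Subset n → Set
  IsConflict C = ¬ Consistent C × (∀ S → S ⊂ C → Consistent S)

  AttackK : Subset n → Fin n → Set
  AttackK S α = Σ (Subset n) λ C → IsConflict C × α ∈ C × S ≡ C - α

  InAllRepairs : Fin n → Set
  InAllRepairs α = ∀ R → IsRepair R → α ∈ R

module SETAF {n : ℕ} (Att : Subset n → Fin n → Set) where

  _⁺ : (Fin n → Set) → Fin n → Set
  (S ⁺) α = Σ (Subset n) λ T → (∀ β → β ∈ T → S β) × Att T α

  Γ : (Fin n → Set) → Fin n → Set
  Γ S α = ∀ T → Att T α → Σ (Fin n) λ β → β ∈ T × (S ⁺) β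

  Γ^ : ℕ → Fin n → Set
  Γ^ zero    = λ _ → ⊥
  Γ^ (suc d) = Γ (Γ^ d)

  Grounded : Fin n → Set
  Grounded α = Σ ℕ λ d → Γ^ d α

GroundedK : {n : ℕ} → KB n → Fin n → Set
GroundedK K = SETAF.Grounded (AttackK K)

module Submission where

-- Both sides are characterised by one notion: α is *free* if it belongs to no
-- conflict.
--   * A free assertion has no attackers at all (every attack on α comes from a
--     conflict containing α), so it lies in Γ¹(∅).
--   * By induction on d, every member of Γᵈ(∅) is free: to defend α against
--     the attack C ∖ {α}, some β ∈ C must be attacked by a set C' ∖ {β} ⊆ Γᵈ⁻¹(∅)
--     coming from a conflict C'; that set is nonempty (singletons are
--     consistent), and its elements are free by induction, although they lie in C'.
--   * Free assertions lie in every repair R: otherwise R ∪ {α} is inconsistent,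
--     hence contains a conflict, which must contain α.
--   * Conversely, if α lies in a conflict C, then C ∖ {α} is consistent and
--     extends to a repair; that repair cannot contain α, as it would contain C.
-- Consistency is not decidable, so "contains a minimal inconsistent subset" and
-- "extends to a maximal consistent subset" are proved in double-negated form
-- (greedy passes over the finitely many assertions), for an arbitrary
-- downward-closed predicate on subsets; this suffices since their uses have
-- negative or decidable goals.

open import Defs
open import Data.Nat using (ℕ; zero; suc)
open import Data.Fin using (Fin)
open import Data.Fin.Properties using (_≟_)
open import Data.Fin.Subset
  using (Subset; _∈_; _∉_; _⊆_; _⊂_; _─_; _-_; _∪_; ⁅_⁆; Empty)
open import Data.Fin.Subset.Properties
  using (_∈?_; nonempty?; x∈⁅x⁆; x∈⁅y⁆⇒x≡y; ⊆-refl; ⊆-trans; p⊆p∪q; x∈p∪q⁺; x∈p∪q⁻; p─q⊆p;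
         x∈p∧x≢y⇒x∈p-y; x∈p⇒p-x⊂p)
open import Data.Vec.Base using (_∷_; there)
open import Data.List.Base using (List; []; _∷_; allFin)
open import Data.List.Membership.Propositional using () renaming (_∈_ to _∈ₗ_)
open import Data.List.Membership.Propositional.Properties using (∈-allFin)
open import Data.List.Relation.Unary.Any using (here; there)
open import Data.Product using (∃; _×_; _,_; proj₁)
open import Data.Sum using (_⊎_; inj₁; inj₂; [_,_]′)
open import Data.Empty using (⊥-elim)
open import Relation.Nullary using (¬_; yes; no)
open import Relation.Nullary.Decidable using (decidable-stable; ¬¬-excluded-middle)
open import Relation.Nullary.Negation using (DoubleNegation; ¬¬-Monad; ¬¬-map)
open import Relation.Binary.PropositionalEquality using (refl; sym; subst)
open import Function.Bundles using (_⇔_; mk⇔)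
open import Effect.Monad using (RawMonad)
open import Level using (0ℓ)

open RawMonad (¬¬-Monad {0ℓ}) using (_>>=_)

private
  variable
    n : ℕ
    p q : Subset n
    x : Fin n

x∈p─q⇒x∉q : (p q : Subset n) → x ∈ p ─ q → x ∉ q
x∈p─q⇒x∉q (_       ∷ p) (_       ∷ q) (there x∈) (there x∈q) = x∈p─q⇒x∉q p q x∈ x∈q

x∉p-x : (p : Subset n) → x ∉ p - x
x∉p-x {x = x} p x∈ = x∈p─q⇒x∉q p ⁅ x ⁆ x∈ (x∈⁅x⁆ x)

p-x⊆p : (p : Subset n) → p - x ⊆ p
p-x⊆p {x = x} p = p─q⊆p p ⁅ x ⁆

⊆-delete : p ⊆ q → x ∉ p → p ⊆ q - x
⊆-delete p⊆q x∉p {y} y∈p = x∈p∧x≢y⇒x∈p-y (p⊆q y∈p) λ { refl → x∉p y∈p }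

delete-⊆ : {p q : Subset n} → p - x ⊆ q → x ∈ q → p ⊆ q
delete-⊆ {x = x} p-x⊆q x∈q {y} y∈p with y ≟ x
... | yes refl = x∈q
... | no  y≢x  = p-x⊆q (x∈p∧x≢y⇒x∈p-y y∈p y≢x)

insert-⊆ : p ⊆ q → x ∈ q → p ∪ ⁅ x ⁆ ⊆ q
insert-⊆ {p = p} {x = x} p⊆q x∈q y∈ with x∈p∪q⁻ p ⁅ x ⁆ y∈
... | inj₁ y∈p = p⊆q y∈p
... | inj₂ y∈x = subst (_∈ _) (sym (x∈⁅y⁆⇒x≡y x y∈x)) x∈q

⊆-insert-avoiding : {p q : Subset n} → p ⊆ q ∪ ⁅ x ⁆ → x ∉ p → p ⊆ q
⊆-insert-avoiding {x = x} {q = q} p⊆ x∉p {y} y∈p with x∈p∪q⁻ q ⁅ x ⁆ (p⊆ y∈p)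
... | inj₁ y∈q = y∈q
... | inj₂ y∈x = ⊥-elim (x∉p (subst (_∈ _) (x∈⁅y⁆⇒x≡y x y∈x) y∈p))

x∈p∪⁅x⁆ : (p : Subset n) (x : Fin n) → x ∈ p ∪ ⁅ x ⁆
x∈p∪⁅x⁆ p x = x∈p∪q⁺ (inj₂ (x∈⁅x⁆ x))

insert-⊂ : x ∉ p → p ⊂ p ∪ ⁅ x ⁆
insert-⊂ {x = x} {p = p} x∉p = p⊆p∪q ⁅ x ⁆ , x , x∈p∪⁅x⁆ p x , x∉p

empty-delete⇒⊆⁅⁆ : Empty (p - x) → p ⊆ ⁅ x ⁆
empty-delete⇒⊆⁅⁆ {x = x} empty {y} y∈p with y ≟ x
... | yes refl = x∈⁅x⁆ x
... | no  y≢x  = ⊥-elim (empty (y , x∈p∧x≢y⇒x∈p-y y∈p y≢x))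

module DownwardClosed {n : ℕ} (P : Subset n → Set)
                      (P-mono : ∀ {X Y} → X ⊆ Y → P Y → P X) where

  Maximal : Subset n → Set
  Maximal R = P R × (∀ S → R ⊂ S → ¬ P S)

  MinimalFailure : Subset n → Set
  MinimalFailure C = ¬ P C × (∀ S → S ⊂ C → P S)

  insertion-maximal⇒maximal : {R : Subset n} → P R
    → (∀ β → β ∈ R ⊎ ¬ P (R ∪ ⁅ β ⁆)) → Maximal R
  insertion-maximal⇒maximal PR saturated = PR , λ where
    S (R⊆S , β , β∈S , β∉R) PS →
      [ β∉R , (λ ¬P[R+β] → ¬P[R+β] (P-mono (insert-⊆ R⊆S β∈S) PS)) ]′ (saturated β)

  deletion-minimal⇒minimal : {C : Subset n} → ¬ P C
    → (∀ β → β ∈ C → P (C - β)) → MinimalFailure C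
  deletion-minimal⇒minimal ¬PC deletable = ¬PC , λ where
    S (S⊆C , β , β∈C , β∉S) → P-mono (⊆-delete S⊆C β∉S) (deletable β β∈C)

  Saturation : List (Fin n) → Subset n → Set
  Saturation xs R =
    ∃ λ R' → R ⊆ R' × P R' × (∀ β → β ∈ₗ xs → β ∈ R' ⊎ ¬ P (R' ∪ ⁅ β ⁆))

  saturate : (xs : List (Fin n)) {R : Subset n} → P R → DoubleNegation (Saturation xs R)
  saturate []       PR = λ k → k (_ , ⊆-refl , PR , λ _ ())
  saturate (x ∷ xs) {R} PR = ¬¬-excluded-middle >>= λ
    { (yes P[R+x]) → ¬¬-map insert-x (saturate xs P[R+x])
    ; (no ¬P[R+x]) → ¬¬-map (skip-x ¬P[R+x]) (saturate xs PR) }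
    where
      insert-x : Saturation xs (R ∪ ⁅ x ⁆) → Saturation (x ∷ xs) R
      insert-x (R' , R+x⊆R' , PR' , sat) = R' , ⊆-trans (p⊆p∪q ⁅ x ⁆) R+x⊆R' , PR' , λ
        { _ (here refl)    → inj₁ (R+x⊆R' (x∈p∪⁅x⁆ R x))
        ; β (there β∈xs) → sat β β∈xs }

      -- if R ∪ ⁅ x ⁆ violates P, so does the larger R' ∪ ⁅ x ⁆
      skip-x : ¬ P (R ∪ ⁅ x ⁆) → Saturation xs R → Saturation (x ∷ xs) R
      skip-x ¬P[R+x] (R' , R⊆R' , PR' , sat) = R' , R⊆R' , PR' , λ
        { _ (here refl)    → inj₂ λ P[R'+x] →
            ¬P[R+x] (P-mono (insert-⊆ (⊆-trans R⊆R' (p⊆p∪q ⁅ x ⁆)) (x∈p∪⁅x⁆ R' x)) P[R'+x])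
        ; β (there β∈xs) → sat β β∈xs }

  Pruning : List (Fin n) → Subset n → Set
  Pruning xs X = ∃ λ C → C ⊆ X × ¬ P C × (∀ β → β ∈ₗ xs → β ∈ C → P (C - β))

  prune : (xs : List (Fin n)) {X : Subset n} → ¬ P X → DoubleNegation (Pruning xs X)
  prune []       ¬PX = λ k → k (_ , ⊆-refl , ¬PX , λ _ ())
  prune (x ∷ xs) {X} ¬PX = ¬¬-excluded-middle >>= λ
    { (yes P[X-x]) → ¬¬-map (keep-x P[X-x]) (prune xs ¬PX)
    ; (no ¬P[X-x]) → ¬¬-map delete-x (prune xs ¬P[X-x]) }
    where
      -- if X - x satisfies P, so does the smaller C - x
      keep-x : P (X - x) → Pruning xs X → Pruning (x ∷ xs) X
      keep-x P[X-x] (C , C⊆X , ¬PC , del) = C , C⊆X , ¬PC , λ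
        { _ (here refl) _ → P-mono (⊆-delete (⊆-trans (p-x⊆p C) C⊆X) (x∉p-x C)) P[X-x]
        ; β (there β∈xs) → del β β∈xs }

      delete-x : Pruning xs (X - x) → Pruning (x ∷ xs) X
      delete-x (C , C⊆X-x , ¬PC , del) = C , ⊆-trans C⊆X-x (p-x⊆p X) , ¬PC , λ
        { _ (here refl) x∈C → ⊥-elim (x∉p-x X (C⊆X-x x∈C))
        ; β (there β∈xs) → del β β∈xs }

  maximal-extension : {B : Subset n} → P B → DoubleNegation (∃ λ R → B ⊆ R × Maximal R)
  maximal-extension {B} PB = ¬¬-map fully-saturated⇒maximal (saturate (allFin n) PB)
    where
      fully-saturated⇒maximal : Saturation (allFin n) B → ∃ λ R → B ⊆ R × Maximal R
      fully-saturated⇒maximal (R , B⊆R , PR , sat) =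
        R , B⊆R , insertion-maximal⇒maximal PR (λ β → sat β (∈-allFin β))

  minimal-failure-within : {X : Subset n} → ¬ P X
    → DoubleNegation (∃ λ C → C ⊆ X × MinimalFailure C)
  minimal-failure-within {X} ¬PX = ¬¬-map fully-pruned⇒minimal (prune (allFin n) ¬PX)
    where
      fully-pruned⇒minimal : Pruning (allFin n) X → ∃ λ C → C ⊆ X × MinimalFailure C
      fully-pruned⇒minimal (C , C⊆X , ¬PC , del) =
        C , C⊆X , deletion-minimal⇒minimal ¬PC (λ β → del β (∈-allFin β))

module _ {n : ℕ} (K : KB n) where
  open SETAF (AttackK K)

  consistent-mono : ∀ {X Y} → X ⊆ Y → Consistent K Y → Consistent K X
  consistent-mono X⊆Y (I , I⊨T , I⊨Y) = I , I⊨T , λ β β∈X → I⊨Y β (X⊆Y β∈X)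

  open DownwardClosed (Consistent K) consistent-mono

  Free : Fin n → Set
  Free α = ∀ C → IsConflict K C → α ∉ C

  -- Every attack on α comes from a conflict containing α, so a free assertion
  -- is unattacked and already in Γ(∅).
  free⇒grounded : ∀ {α} → Free α → Grounded α
  free⇒grounded free = 1 , λ _ (C , C-conflict , α∈C , _) → ⊥-elim (free C C-conflict α∈C)

  -- Defending α ∈ C against C - α needs some
  -- β ∈ C attacked by C' - β ⊆ Γᵈ⁻¹(∅) for a conflict C'; as ⁅ β ⁆ is consistent,
  -- C' - β has an element, which is free by induction yet lies in C'.
  Γ^⇒free : (∀ α → Consistent K ⁅ α ⁆) → ∀ d {α} → Γ^ d α → Free α
  Γ^⇒free single zero    ()
  Γ^⇒free single (suc d) {α} α∈Γ C C-conflict α∈C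
    with α∈Γ (C - α) (C , C-conflict , α∈C , refl)
  ... | β , _ , _ , C'-β⊆Γ^d , C' , C'-conflict , _ , refl with nonempty? (C' - β)
  ...   | yes (γ , γ∈C'-β) =
    Γ^⇒free single d (C'-β⊆Γ^d γ γ∈C'-β) C' C'-conflict (p-x⊆p C' γ∈C'-β)
  ...   | no  C'-β-empty   =
    proj₁ C'-conflict (consistent-mono (empty-delete⇒⊆⁅⁆ C'-β-empty) (single β))

  conflict-within-insert : ∀ {R C α} → Consistent K R → IsConflict K C
    → C ⊆ R ∪ ⁅ α ⁆ → α ∈ C
  conflict-within-insert {α = α} R-cons (C-incons , _) C⊆R+α = decidable-stable (α ∈? _)
    λ α∉C → C-incons (consistent-mono (⊆-insert-avoiding C⊆R+α α∉C) R-cons)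

  -- A free assertion lies in every repair R: otherwise R ∪ ⁅ α ⁆ is inconsistent
  -- by maximality and contains a conflict, which must contain α.
  free⇒inAllRepairs : ∀ {α} → Free α → InAllRepairs K α
  free⇒inAllRepairs {α} free R (R-cons , R-max) = decidable-stable (α ∈? R) λ α∉R →
    minimal-failure-within (R-max (R ∪ ⁅ α ⁆) (insert-⊂ α∉R)) λ (C , C⊆R+α , C-conflict) →
      free C C-conflict (conflict-within-insert R-cons C-conflict C⊆R+α)

  -- If α lies in a conflict C, then C - α is consistent and extends to a repair
  -- R; were α ∈ R, the whole conflict C would lie in the consistent R.
  inAllRepairs⇒free : ∀ {α} → InAllRepairs K α → Free α
  inAllRepairs⇒free in-all C (C-incons , C-min) α∈C =
    maximal-extension (C-min _ (x∈p⇒p-x⊂p α∈C)) λ (R , C-α⊆R , R-repair) →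
      C-incons (consistent-mono (delete-⊆ C-α⊆R (in-all R R-repair)) (proj₁ R-repair))

mainTheorem3 : {n : ℕ} (K : KB n)
    → (∀ α → Consistent K ⁅ α ⁆)
    → ∀ α → GroundedK K α ⇔ InAllRepairs K α
mainTheorem3 K single α = mk⇔
  (λ (d , α∈Γ^d) → free⇒inAllRepairs K (Γ^⇒free K single d α∈Γ^d))
  (λ in-all → free⇒grounded K (inAllRepairs⇒free K in-all))
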